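{- Let $G=(V,E)$ be a directed graph with $n$ vertices, $(s,t)$ a vertex pair with $t$ reachable from $s$, and let $H_{(s,t)}$, the outer strands $P^1,P^2$, and nice paths be as defined in the context. Then for any two edges $f_1,f_2\in E$, if there is an $s$ to $t$ path in $G\setminus\{f_1,f_2\}$, then there is a nice $s$ to $t$ path in $H_{(s,t)}\setminus\{f_1,f_2\}$.
   Context: For a path $P$ and vertices $u,v$ on $P$, write $u<_P v$ if $u$ appears before $v$ on $P$, and let $P[u-v]$ be the subpath of $P$ from $u$ to $v$. An $s$–$t$ cut-edge (cut-vertex) is an edge (vertex) whose removal destroys all $s$ to $t$ paths. Fix two $s$ to $t$ paths $P^1,P^2$ (the outer strands) that intersect only at $s$–$t$ cut-edges and $s$–$t$ cut-vertices. For each vertex $v$ on $P^1\cup P^2$ and $i\in\{1,2\}$, the coupling point $u^i_v$ (if it exists) is the vertex $u$ of $P^i$ that is earliest on $P^i$ among those vertices from which there is a $u$ to $v$ path in $G$ edge-disjoint from both $P^1$ and $P^2$; the coupling path $Q^i_v$ is an arbitrarily fixed such $u^i_v$ to $v$ path edge-disjoint from $P^1$ and $P^2$. The subgraph $H_{(s,t)}$ has vertex set $V$ and contains all edges of $P^1$ and $P^2$, and, for every $i,j\in\{1,2\}$ and every $v\in V(P^j)$ having a coupling point $u^i_v$, contains all edges of $Q^i_v$ provided that for every vertex $v'$ appearing strictly after $v$ on $P^j$ that has a coupling point on $P^i$, we have $u^i_v<_{P^i}u^i_{v'}$. An $s$ to $t$ path in $H_{(s,t)}$ is nice if it has the form $P^i[s-u]\circ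 Q\circ P^j[u'-t]$ for some $i,j\in\{1,2\}$, where $Q$ is either empty (so $u=u'$) or is a coupling path $Q^i_{u'}$ contained in $H_{(s,t)}$ that starts at $u$ and is edge-disjoint from $P^1$ and $P^2$. -}

module Defs where

open import Data.Nat using (ℕ)
open import Data.Fin using (Fin; zero; suc)
open import Data.List using (List; []; _∷_)
open import Data.List.Membership.Propositional using (_∈_; _∉_)
open import Data.List.Relation.Unary.All using (All)
open import Data.List.Relation.Unary.Unique.Propositional using (Unique)
open import Data.Maybe using (Maybe; just; nothing)
open import Data.Product using (Σ; Σ-syntax; ∃-syntax; _×_; _,_)
open import Data.Sum using (_⊎_)
open import Relation.Binary.PropositionalEquality using (_≡_)
open import Relation.Nullary using (¬_)

-- A directed graph on the vertex set Fin n is given by its edge relation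
-- E : Fin n → Fin n → Set  (E u v = "there is an edge u → v").
-- Edges are identified with ordered vertex pairs.
Edge : ℕ → Set
Edge n = Fin n × Fin n

data Walk {n : ℕ} (E : Fin n → Fin n → Set) : Fin n → Fin n → Set where
  [_]    : (u : Fin n) → Walk E u u
  _∷⟨_⟩_ : (u : Fin n) {w v : Fin n} → E u w → Walk E w v → Walk E u v

module _ {n : ℕ} {E : Fin n → Fin n → Set} where

  verts : ∀ {u v} → Walk E u v → List (Fin n)
  verts [ u ] = u ∷ []
  verts (u ∷⟨ _ ⟩ p) = u ∷ verts p

  edges : ∀ {u v} → Walk E u v → List (Edge n)
  edges [ u ] = []
  edges (_∷⟨_⟩_ u {w} _ p) = (u , w) ∷ edges p

  _++ᵂ_ : ∀ {u w v} → Walk E u w → Walk E w v → Walk E u v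
  [ u ] ++ᵂ q = q
  (u ∷⟨ e ⟩ p) ++ᵂ q = u ∷⟨ e ⟩ (p ++ᵂ q)

  infixr 5 _++ᵂ_

  IsPath : ∀ {u v} → Walk E u v → Set
  IsPath p = Unique (verts p)

data Before {A : Set} : List A → A → A → Set where
  here  : ∀ {u v xs} → v ∈ xs → Before (u ∷ xs) u v
  there : ∀ {x u v xs} → Before xs u v → Before (x ∷ xs) u v

-- The setting: graph E, pair (s,t), and the two outer strands P 0, P 1
-- (playing the roles of P^1, P^2).
module Setting {n : ℕ} (E : Fin n → Fin n → Set) (s t : Fin n)
               (P : Fin 2 → Walk E s t) where

  CutVertex : Fin n → Set
  CutVertex x = ¬ (Σ[ R ∈ Walk E s t ] IsPath R × x ∉ verts R)

  CutEdge : Edge n → Set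
  CutEdge e = ¬ (Σ[ R ∈ Walk E s t ] IsPath R × e ∉ edges R)

  record OuterStrands : Set where
    field
      strand-path : ∀ i → IsPath (P i)
      common-vertex-cut : ∀ x → x ∈ verts (P zero) → x ∈ verts (P (suc zero)) → CutVertex x
      common-edge-cut : ∀ e → e ∈ edges (P zero) → e ∈ edges (P (suc zero)) → CutEdge e

  EdgeDisjoint : ∀ {u v} → Walk E u v → Set
  EdgeDisjoint q = ∀ i e → e ∈ edges q → e ∉ edges (P i)

  DisjPathFrom : Fin n → Fin n → Set
  DisjPathFrom u v = Σ[ q ∈ Walk E u v ] IsPath q × EdgeDisjoint q

  CouplingPoint : Fin 2 → Fin n → Fin n → Set
  CouplingPoint i v u =
    u ∈ verts (P i) × DisjPathFrom u v ×
    (∀ w → w ∈ verts (P i) → DisjPathFrom w v → ¬ Before (verts (P i)) w u)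

  -- An arbitrarily fixed choice of coupling paths:
  -- Q i v = just (u , q) means u = u^i_v and q = Q^i_v;
  -- Q i v = nothing means v has no coupling point on P^i.
  record CouplingChoice : Set where
    field
      Q : (i : Fin 2) (v : Fin n) → Maybe (Σ[ u ∈ Fin n ] Walk E u v)
      Q-just : ∀ i v u (q : Walk E u v) → Q i v ≡ just (u , q) →
               CouplingPoint i v u × IsPath q × EdgeDisjoint q
      Q-nothing : ∀ i v → Q i v ≡ nothing → ∀ u → ¬ CouplingPoint i v u

  module _ (C : CouplingChoice) where
    open CouplingChoice C

    InH : Edge n → Set
    InH e =
      (Σ[ i ∈ Fin 2 ] e ∈ edges (P i)) ⊎
      (Σ[ i ∈ Fin 2 ] Σ[ j ∈ Fin 2 ] Σ[ v ∈ Fin n ] Σ[ u ∈ Fin n ] Σ[ q ∈ Walk E u v ]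
         v ∈ verts (P j) × Q i v ≡ just (u , q) × e ∈ edges q ×
         (∀ v' u' (q' : Walk E u' v') → Before (verts (P j)) v v' →
            Q i v' ≡ just (u' , q') → Before (verts (P i)) u u'))

    IsNice : Walk E s t → Set
    IsNice R =
      Σ[ i ∈ Fin 2 ] Σ[ j ∈ Fin 2 ] Σ[ u ∈ Fin n ] Σ[ u' ∈ Fin n ]
      Σ[ A ∈ Walk E s u ] Σ[ B ∈ Walk E u t ]
      Σ[ D ∈ Walk E s u' ] Σ[ F ∈ Walk E u' t ] Σ[ Qp ∈ Walk E u u' ]
        P i ≡ A ++ᵂ B × P j ≡ D ++ᵂ F × R ≡ A ++ᵂ Qp ++ᵂ F ×
        (edges Qp ≡ [] ⊎
         (Q i u' ≡ just (u , Qp) × All InH (edges Qp) × EdgeDisjoint Qp))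

{-# OPTIONS --safe #-}
-- If one outer strand avoids f₁ and f₂, it is itself nice. Otherwise each strand carries exactly
-- one failed edge: an edge on both strands is an s–t cut-edge, yet the surviving path R avoids
-- f₁ and f₂. Hence every strand vertex c has a prefix P^k[s-c] or a suffix P^k[c-t] that avoids
-- f₁ and f₂ (is clean).
-- Reading R from s yields a vertex y with clean prefix on some P^i, a vertex z with clean suffix
-- on some P^j, and a segment of R from y to z edge-disjoint from both strands; so z has a
-- coupling point on P^i, and it is not after y. Let v be the last vertex of P^j from z on whose
-- coupling point u on P^i is not after y. Every later vertex of P^j has its coupling point after
-- y, hence after u, so Q^i_v lies in H_(s,t), and P^i[s-u] ∘ Q^i_v ∘ P^j[v-t] avoids f₁ and f₂.
-- It is a path because a repeated vertex would contradict the minimality of u or of the coupling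
-- point of a vertex of P^j after v.

module Submission where

open import Defs
open import Data.Fin using (Fin)
open import Data.Product using (Σ-syntax; _×_; proj₁; proj₂)
open import Data.List.Membership.Propositional using (_∉_)
open import Data.List.Relation.Unary.All using (All)

open import Data.Nat using (ℕ)
open import Data.Fin as Fin using (zero; suc)
open import Data.Fin.Properties using (any?)
open import Data.Maybe using (just; nothing)
open import Data.List using (List; []; _∷_; _++_)
open import Data.List.Membership.Propositional using (_∈_)
open import Data.List.Membership.Propositional.Properties using (∈-++⁺ˡ; ∈-++⁺ʳ; ∈-++⁻)
import Data.List.Membership.DecPropositional as DecMembership
open import Data.List.Relation.Unary.Any using (here; there)
open import Data.List.Relation.Unary.All as All using ([]; _∷_)
import Data.List.Relation.Unary.All.Properties as All
open import Data.List.Relation.Unary.AllPairs using ([]; _∷_)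
open import Data.List.Relation.Unary.Unique.Propositional using (Unique)
open import Data.List.Relation.Unary.Unique.Propositional.Properties using (++⁺)
open import Data.List.Relation.Binary.Disjoint.Propositional using (Disjoint)
open import Data.Product using (_,_)
open import Data.Product.Properties using (≡-dec)
open import Data.Sum as Sum using (_⊎_; inj₁; inj₂; [_,_]′)
open import Data.Empty using (⊥; ⊥-elim)
open import Function using (id; _∘_; flip)
open import Relation.Nullary using (¬_; Dec; yes; no)
open import Relation.Nullary.Decidable using (map′; _×-dec_; _⊎-dec_; decidable-stable)
open import Relation.Unary using (Decidable; ∁)
open import Relation.Binary.Definitions using (DecidableEquality)
open import Relation.Binary.PropositionalEquality using (_≡_; refl; sym; trans; cong; subst)
open Relation.Binary.PropositionalEquality.≡-Reasoning

module _ {A : Set} where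

  Unique-++⁻ˡ : ∀ (xs : List A) {ys} → Unique (xs ++ ys) → Unique xs
  Unique-++⁻ˡ []       _          = []
  Unique-++⁻ˡ (x ∷ xs) (x∉ ∷ xs!) = All.++⁻ˡ xs x∉ ∷ Unique-++⁻ˡ xs xs!

  Unique-++⇒Disjoint : ∀ (xs : List A) {ys} → Unique (xs ++ ys) → Disjoint xs ys
  Unique-++⇒Disjoint (x ∷ xs) (x∉ ∷ _)   (here refl , v∈ys) =
    All.lookup x∉ (∈-++⁺ʳ xs v∈ys) refl
  Unique-++⇒Disjoint (x ∷ xs) (_ ∷ xs!) (there v∈xs , v∈ys) =
    Unique-++⇒Disjoint xs xs! (v∈xs , v∈ys)

  Before-∈ˡ : ∀ {xs : List A} {u v} → Before xs u v → u ∈ xs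
  Before-∈ˡ (here _)  = here refl
  Before-∈ˡ (there b) = there (Before-∈ˡ b)

  Before-∈ʳ : ∀ {xs : List A} {u v} → Before xs u v → v ∈ xs
  Before-∈ʳ (here v∈) = there v∈
  Before-∈ʳ (there b) = there (Before-∈ʳ b)

  Before-trans : ∀ {xs : List A} {a b c} → Unique xs → Before xs a b → Before xs b c → Before xs a c
  Before-trans (a∉ ∷ _)  (here b∈)   (here _)    = ⊥-elim (All.lookup a∉ b∈ refl)
  Before-trans _         (here _)    (there b<c) = here (Before-∈ʳ b<c)
  Before-trans (b∉ ∷ _)  (there a<b) (here _)    = ⊥-elim (All.lookup b∉ (Before-∈ʳ a<b) refl)
  Before-trans (_ ∷ xs!) (there a<b) (there b<c) = there (Before-trans xs! a<b b<c)

  Before-trichotomy : ∀ {xs : List A} {u v} → u ∈ xs → v ∈ xs →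
                      Before xs u v ⊎ u ≡ v ⊎ Before xs v u
  Before-trichotomy (here refl) (here refl) = inj₂ (inj₁ refl)
  Before-trichotomy (here refl) (there v∈)  = inj₁ (here v∈)
  Before-trichotomy (there u∈)  (here refl) = inj₂ (inj₂ (here u∈))
  Before-trichotomy (there u∈)  (there v∈)  =
    Sum.map there (Sum.map id there) (Before-trichotomy u∈ v∈)

  ≮-Before-trans : ∀ {xs : List A} {y u u'} → Unique xs → u ∈ xs →
                   ¬ Before xs y u → Before xs y u' → Before xs u u'
  ≮-Before-trans xs! u∈ y≮u y<u' with Before-trichotomy u∈ (Before-∈ˡ y<u')
  ... | inj₁ u<y         = Before-trans xs! u<y y<u'
  ... | inj₂ (inj₁ refl) = y<u'
  ... | inj₂ (inj₂ y<u)  = ⊥-elim (y≮u y<u)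

  Before-++-∷⁺ˡ : ∀ (ys : List A) {x c zs} → x ∈ ys → Before (ys ++ c ∷ zs) x c
  Before-++-∷⁺ˡ (y ∷ ys) (here refl) = here (∈-++⁺ʳ ys (here refl))
  Before-++-∷⁺ˡ (y ∷ ys) (there x∈)  = there (Before-++-∷⁺ˡ ys x∈)

  Before-++-∷⁺ʳ : ∀ (ys : List A) {x c zs} → x ∈ zs → Before (ys ++ c ∷ zs) c x
  Before-++-∷⁺ʳ []       x∈ = here x∈
  Before-++-∷⁺ʳ (y ∷ ys) x∈ = there (Before-++-∷⁺ʳ ys x∈)

  Before-++-∷⁻ˡ : ∀ (ys : List A) {x c zs} → Unique (ys ++ c ∷ zs) →
                  Before (ys ++ c ∷ zs) x c → x ∈ ys
  Before-++-∷⁻ˡ []       (c∉ ∷ _)  (here c∈)   = ⊥-elim (All.lookup c∉ c∈ refl)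
  Before-++-∷⁻ˡ []       (c∉ ∷ _)  (there x<c) = ⊥-elim (All.lookup c∉ (Before-∈ʳ x<c) refl)
  Before-++-∷⁻ˡ (y ∷ ys) _         (here _)    = here refl
  Before-++-∷⁻ˡ (y ∷ ys) (_ ∷ xs!) (there x<c) = there (Before-++-∷⁻ˡ ys xs! x<c)

  Before-++-∷⁻ʳ : ∀ (ys : List A) {x c zs} → Unique (ys ++ c ∷ zs) →
                  Before (ys ++ c ∷ zs) c x → x ∈ zs
  Before-++-∷⁻ʳ []       _         (here x∈)   = x∈
  Before-++-∷⁻ʳ []       (c∉ ∷ _)  (there c<x) = ⊥-elim (All.lookup c∉ (Before-∈ˡ c<x) refl)
  Before-++-∷⁻ʳ (y ∷ ys) (y∉ ∷ _)  (here _)    =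
    ⊥-elim (All.lookup y∉ (∈-++⁺ʳ ys (here refl)) refl)
  Before-++-∷⁻ʳ (y ∷ ys) (_ ∷ xs!) (there c<x) = Before-++-∷⁻ʳ ys xs! c<x

  Minimal : List A → (A → Set) → A → Set
  Minimal xs D u = u ∈ xs × D u × (∀ w → w ∈ xs → D w → ¬ Before xs w u)

  ¬¬-minimal : ∀ {D : A → Set} {xs w} → Unique xs → w ∈ xs → D w →
               ¬ ¬ (Σ[ u ∈ A ] Minimal xs D u)
  ¬¬-minimal {D} {x ∷ xs} (x∉ ∷ xs!) w∈ Dw no-minimal = absent w∈ Dw
    where
    nothing-before-x : ∀ {w} → ¬ Before (x ∷ xs) w x
    nothing-before-x (here x∈)   = All.lookup x∉ x∈ refl
    nothing-before-x (there w<x) = All.lookup x∉ (Before-∈ʳ w<x) refl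
    ¬Dx : ¬ D x
    ¬Dx Dx = no-minimal (x , here refl , Dx , λ _ _ _ → nothing-before-x)
    absent : ∀ {w} → w ∈ x ∷ xs → ¬ D w
    absent (here refl) = ¬Dx
    absent (there w∈xs) Dw = ¬¬-minimal xs! w∈xs Dw λ (u , u∈ , Du , minimal) →
      no-minimal (u , there u∈ , Du , λ where
        _ _ Dx (here _)    → ¬Dx Dx
        w _ Dw (there w<u) → minimal w (Before-∈ˡ w<u) Dw w<u)

  module _ (_≟_ : DecidableEquality A) where
    open DecMembership _≟_ using (_∈?_)

    before? : ∀ xs u v → Dec (Before xs u v)
    before? []       u v = no λ ()
    before? (x ∷ xs) u v = map′ from to ((x ≟ u ×-dec v ∈? xs) ⊎-dec before? xs u v)
      where
      from : (x ≡ u × v ∈ xs) ⊎ Before xs u v → Before (x ∷ xs) u v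
      from (inj₁ (refl , v∈)) = here v∈
      from (inj₂ u<v)         = there u<v
      to : Before (x ∷ xs) u v → (x ≡ u × v ∈ xs) ⊎ Before xs u v
      to (here v∈)   = inj₁ (refl , v∈)
      to (there u<v) = inj₂ u<v

module _ {n : ℕ} {E : Fin n → Fin n → Set} where

  initVerts : ∀ {u v} → Walk E u v → List (Fin n)
  initVerts [ u ]         = []
  initVerts (u ∷⟨ _ ⟩ W) = u ∷ initVerts W

  tailVerts : ∀ {u v} → Walk E u v → List (Fin n)
  tailVerts [ u ]         = []
  tailVerts (u ∷⟨ _ ⟩ W) = verts W

  verts-∷ : ∀ {u v} (W : Walk E u v) → verts W ≡ u ∷ tailVerts W
  verts-∷ [ u ]         = refl
  verts-∷ (u ∷⟨ _ ⟩ W) = refl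

  verts-∷ʳ : ∀ {u v} (W : Walk E u v) → verts W ≡ initVerts W ++ v ∷ []
  verts-∷ʳ [ u ]         = refl
  verts-∷ʳ (u ∷⟨ _ ⟩ W) = cong (u ∷_) (verts-∷ʳ W)

  verts-++ : ∀ {u w v} (A : Walk E u w) (B : Walk E w v) → verts (A ++ᵂ B) ≡ initVerts A ++ verts B
  verts-++ [ u ]         B = refl
  verts-++ (u ∷⟨ _ ⟩ A) B = cong (u ∷_) (verts-++ A B)

  verts-++-∷ : ∀ {u w v} (A : Walk E u w) (B : Walk E w v) →
               verts (A ++ᵂ B) ≡ initVerts A ++ w ∷ tailVerts B
  verts-++-∷ A B = trans (verts-++ A B) (cong (initVerts A ++_) (verts-∷ B))

  edges-++ : ∀ {u w v} (A : Walk E u w) (B : Walk E w v) → edges (A ++ᵂ B) ≡ edges A ++ edges B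
  edges-++ [ u ]         B = refl
  edges-++ (_∷⟨_⟩_ u {w} _ A) B = cong ((u , w) ∷_) (edges-++ A B)

  ++ᵂ-assoc : ∀ {a b c d} (A : Walk E a b) (B : Walk E b c) (C : Walk E c d) →
              (A ++ᵂ B) ++ᵂ C ≡ A ++ᵂ B ++ᵂ C
  ++ᵂ-assoc [ _ ]         B C = refl
  ++ᵂ-assoc (u ∷⟨ e ⟩ A) B C = cong (u ∷⟨ e ⟩_) (++ᵂ-assoc A B C)

  ++ᵂ-identityʳ : ∀ {u v} (A : Walk E u v) → A ++ᵂ [ v ] ≡ A
  ++ᵂ-identityʳ [ _ ]         = refl
  ++ᵂ-identityʳ (u ∷⟨ e ⟩ A) = cong (u ∷⟨ e ⟩_) (++ᵂ-identityʳ A)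

  head∈verts : ∀ {u v} (W : Walk E u v) → u ∈ verts W
  head∈verts [ u ]         = here refl
  head∈verts (u ∷⟨ _ ⟩ _) = here refl

  initVerts⊆verts : ∀ {u v x} (W : Walk E u v) → x ∈ initVerts W → x ∈ verts W
  initVerts⊆verts (u ∷⟨ _ ⟩ W) (here refl) = here refl
  initVerts⊆verts (u ∷⟨ _ ⟩ W) (there x∈)  = there (initVerts⊆verts W x∈)

  source∈initVerts : ∀ {u v} {f : Edge n} (W : Walk E u v) → f ∈ edges W → proj₁ f ∈ initVerts W
  source∈initVerts (u ∷⟨ _ ⟩ W) (here refl) = here refl
  source∈initVerts (u ∷⟨ _ ⟩ W) (there f∈)  = there (source∈initVerts W f∈)

  ∈-verts⁻ : ∀ {u v x} (W : Walk E u v) → x ∈ verts W → x ≡ u ⊎ x ∈ tailVerts W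
  ∈-verts⁻ [ u ]         (here refl) = inj₁ refl
  ∈-verts⁻ (u ∷⟨ _ ⟩ W) (here refl) = inj₁ refl
  ∈-verts⁻ (u ∷⟨ _ ⟩ W) (there x∈)  = inj₂ x∈

  verts-++⁺ˡ : ∀ {u w v x} (A : Walk E u w) (B : Walk E w v) →
               x ∈ verts A → x ∈ verts (A ++ᵂ B)
  verts-++⁺ˡ [ u ]         B (here refl) = head∈verts B
  verts-++⁺ˡ (u ∷⟨ _ ⟩ A) B (here refl) = here refl
  verts-++⁺ˡ (u ∷⟨ _ ⟩ A) B (there x∈)  = there (verts-++⁺ˡ A B x∈)

  ∈-verts-++⁻ : ∀ {u w v x} (A : Walk E u w) {B : Walk E w v} →
                x ∈ verts (A ++ᵂ B) → x ∈ verts A ⊎ x ∈ tailVerts B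
  ∈-verts-++⁻ [ u ]         {B} x∈ = Sum.map (λ { refl → here refl }) id (∈-verts⁻ B x∈)
  ∈-verts-++⁻ (u ∷⟨ _ ⟩ A) (here refl) = inj₁ (here refl)
  ∈-verts-++⁻ (u ∷⟨ _ ⟩ A) (there x∈)  = Sum.map there id (∈-verts-++⁻ A x∈)

  ∈-edges-++⁺ : ∀ {u w v} {f : Edge n} (A : Walk E u w) {B : Walk E w v} →
                f ∈ edges A ⊎ f ∈ edges B → f ∈ edges (A ++ᵂ B)
  ∈-edges-++⁺ A {B} = subst (_ ∈_) (sym (edges-++ A B)) ∘ [ ∈-++⁺ˡ , ∈-++⁺ʳ (edges A) ]′

  ∈-edges-++⁻ : ∀ {u w v} {f : Edge n} (A : Walk E u w) {B : Walk E w v} →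
                f ∈ edges (A ++ᵂ B) → f ∈ edges A ⊎ f ∈ edges B
  ∈-edges-++⁻ A {B} = ∈-++⁻ (edges A) ∘ subst (_ ∈_) (edges-++ A B)

  ∉-edges-++ : ∀ {u w v} {f : Edge n} {A : Walk E u w} {B : Walk E w v} →
               f ∉ edges A → f ∉ edges B → f ∉ edges (A ++ᵂ B)
  ∉-edges-++ {A = A} f∉A f∉B = [ f∉A , f∉B ]′ ∘ ∈-edges-++⁻ A

  split-at : ∀ {u v c} (W : Walk E u v) → c ∈ verts W →
             Σ[ A ∈ Walk E u c ] Σ[ B ∈ Walk E c v ] W ≡ A ++ᵂ B
  split-at [ u ]         (here refl) = [ u ] , [ u ] , refl
  split-at (u ∷⟨ e ⟩ W) (here refl) = [ u ] , u ∷⟨ e ⟩ W , refl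
  split-at (u ∷⟨ e ⟩ W) (there c∈) with split-at W c∈
  ... | A , B , refl = u ∷⟨ e ⟩ A , B , refl

  IsPath-initVerts : ∀ {u v} (W : Walk E u v) → IsPath W → Unique (initVerts W)
  IsPath-initVerts W W-path = Unique-++⁻ˡ (initVerts W) (subst Unique (verts-∷ʳ W) W-path)

  IsPath-last∉initVerts : ∀ {u v} (W : Walk E u v) → IsPath W → v ∉ initVerts W
  IsPath-last∉initVerts W W-path v∈ =
    Unique-++⇒Disjoint (initVerts W) (subst Unique (verts-∷ʳ W) W-path) (v∈ , here refl)

  IsPath-++⁻ˡ : ∀ {u w v} (A : Walk E u w) (B : Walk E w v) → IsPath (A ++ᵂ B) → IsPath A
  IsPath-++⁻ˡ [ u ]         B _           = [] ∷ []
  IsPath-++⁻ˡ (u ∷⟨ _ ⟩ A) B (u∉ ∷ AB!) =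
    All.tabulate (All.lookup u∉ ∘ verts-++⁺ˡ A B) ∷ IsPath-++⁻ˡ A B AB!

  IsPath-++⁻ʳ : ∀ {u w v} (A : Walk E u w) (B : Walk E w v) → IsPath (A ++ᵂ B) → IsPath B
  IsPath-++⁻ʳ [ u ]         B AB!       = AB!
  IsPath-++⁻ʳ (u ∷⟨ _ ⟩ A) B (_ ∷ AB!) = IsPath-++⁻ʳ A B AB!

  IsPath-++⁺ : ∀ {u w v} {A : Walk E u w} {B : Walk E w v} →
               Unique (initVerts A) → IsPath B → Disjoint (initVerts A) (verts B) → IsPath (A ++ᵂ B)
  IsPath-++⁺ {A = A} {B} A! B-path disjoint = subst Unique (sym (verts-++ A B)) (++⁺ A! B-path disjoint)

  IsPath-++⇒Disjoint-edges : ∀ {u w v} (A : Walk E u w) (B : Walk E w v) →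
                             IsPath (A ++ᵂ B) → Disjoint (edges A) (edges B)
  IsPath-++⇒Disjoint-edges A B AB-path (f∈A , f∈B) =
    Unique-++⇒Disjoint (initVerts A) (subst Unique (verts-++ A B) AB-path)
      (source∈initVerts A f∈A , initVerts⊆verts B (source∈initVerts B f∈B))

  module _ {u w v} {W : Walk E u v} (A : Walk E u w) (B : Walk E w v) where

    junction∈verts : W ≡ A ++ᵂ B → w ∈ verts W
    junction∈verts refl rewrite verts-++-∷ A B = ∈-++⁺ʳ (initVerts A) (here refl)

    ∈-edges-split⁺ : ∀ {f} → W ≡ A ++ᵂ B → f ∈ edges A ⊎ f ∈ edges B → f ∈ edges W
    ∈-edges-split⁺ refl = ∈-edges-++⁺ A

    Before-split⁺ˡ : ∀ {x} → W ≡ A ++ᵂ B → x ∈ initVerts A → Before (verts W) x w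
    Before-split⁺ˡ refl x∈ rewrite verts-++-∷ A B = Before-++-∷⁺ˡ (initVerts A) x∈

    Before-split⁺ʳ : ∀ {x} → W ≡ A ++ᵂ B → x ∈ tailVerts B → Before (verts W) w x
    Before-split⁺ʳ refl x∈ rewrite verts-++-∷ A B = Before-++-∷⁺ʳ (initVerts A) x∈

    Before-split⁻ˡ : ∀ {x} → W ≡ A ++ᵂ B → IsPath W → Before (verts W) x w → x ∈ initVerts A
    Before-split⁻ˡ refl W-path x<w rewrite verts-++-∷ A B = Before-++-∷⁻ˡ (initVerts A) W-path x<w

    Before-split⁻ʳ : ∀ {x} → W ≡ A ++ᵂ B → IsPath W → Before (verts W) w x → x ∈ tailVerts B
    Before-split⁻ʳ refl W-path w<x rewrite verts-++-∷ A B = Before-++-∷⁻ʳ (initVerts A) W-path w<x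

  first-edge : ∀ {c c' v} (W : Walk E c v) → IsPath W → (c , c') ∈ edges W →
               Σ[ e ∈ E c c' ] Σ[ W' ∈ Walk E c' v ] W ≡ c ∷⟨ e ⟩ W'
  first-edge [ _ ]         _        ()
  first-edge (c ∷⟨ e ⟩ W) _        (here refl) = e , W , refl
  first-edge (c ∷⟨ e ⟩ W) (c∉ ∷ _) (there c∈)  =
    ⊥-elim (All.lookup c∉ (initVerts⊆verts W (source∈initVerts W c∈)) refl)

  edge-after-split : ∀ {u c c' v} {W : Walk E u v} (A : Walk E u c) (B : Walk E c v) →
                     W ≡ A ++ᵂ B → IsPath W → (c , c') ∈ edges W →
                     Σ[ e ∈ E c c' ] Σ[ B' ∈ Walk E c' v ] B ≡ c ∷⟨ e ⟩ B'
  edge-after-split A B refl W-path e∈ with ∈-edges-++⁻ A e∈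
  ... | inj₁ e∈A = ⊥-elim (Unique-++⇒Disjoint (initVerts A) (subst Unique (verts-++ A B) W-path)
                             (source∈initVerts A e∈A , head∈verts B))
  ... | inj₂ e∈B = first-edge B (IsPath-++⁻ʳ A B W-path) e∈B

  module _ {Pr : Fin n → Set} (Pr? : Decidable Pr) where

    LastSplit : ∀ {u v} → Walk E u v → Set
    LastSplit {u} {v} W = Σ[ w ∈ Fin n ] Σ[ W₁ ∈ Walk E u w ] Σ[ W₂ ∈ Walk E w v ]
                          W ≡ W₁ ++ᵂ W₂ × Pr w × All (∁ Pr) (tailVerts W₂)

    last-split-or-none : ∀ {u v} (W : Walk E u v) → LastSplit W ⊎ All (∁ Pr) (verts W)
    last-split-or-none [ u ] with Pr? u
    ... | yes Pu = inj₁ (u , [ u ] , [ u ] , refl , Pu , [])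
    ... | no ¬Pu = inj₂ (¬Pu ∷ [])
    last-split-or-none (u ∷⟨ e ⟩ W) with last-split-or-none W | Pr? u
    ... | inj₁ (w , W₁ , W₂ , refl , Pw , none-later) | _ =
      inj₁ (w , u ∷⟨ e ⟩ W₁ , W₂ , refl , Pw , none-later)
    ... | inj₂ none | yes Pu = inj₁ (u , [ u ] , u ∷⟨ e ⟩ W , refl , Pu , none)
    ... | inj₂ none | no ¬Pu = inj₂ (¬Pu ∷ none)

    last-split : ∀ {u v} (W : Walk E u v) → Pr u → LastSplit W
    last-split W Pu =
      [ id , (λ none → ⊥-elim (All.lookup none (head∈verts W) Pu)) ]′ (last-split-or-none W)

module Strands {n : ℕ} (E : Fin n → Fin n → Set) (s t : Fin n) (P : Fin 2 → Walk E s t)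
               (strands : Setting.OuterStrands E s t P) (C : Setting.CouplingChoice E s t P) where

  open Setting E s t P
  open OuterStrands strands
  open CouplingChoice C
  open DecMembership (≡-dec (Fin._≟_ {n}) (Fin._≟_ {n})) using (_∈?_)

  NiceAvoiding : Edge n → Edge n → Set
  NiceAvoiding f₁ f₂ = Σ[ R ∈ Walk E s t ]
    IsPath R × All (InH C) (edges R) × f₁ ∉ edges R × f₂ ∉ edges R × IsNice C R

  OnStrand : Edge n → Set
  OnStrand f = Σ[ k ∈ Fin 2 ] f ∈ edges (P k)

  on-strand? : Decidable OnStrand
  on-strand? f = any? λ k → f ∈? edges (P k)

  EdgeDisjoint-++⁺ : ∀ {u w v} {A : Walk E u w} {B : Walk E w v} →
                     EdgeDisjoint A → EdgeDisjoint B → EdgeDisjoint (A ++ᵂ B)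
  EdgeDisjoint-++⁺ {A = A} A-disj B-disj k f = [ A-disj k f , B-disj k f ]′ ∘ ∈-edges-++⁻ A

  DisjPathFrom-refl : ∀ x → DisjPathFrom x x
  DisjPathFrom-refl x = [ x ] , [] ∷ [] , λ _ _ ()

  DisjPathFrom-split : ∀ {u v x} {q : Walk E u v} → IsPath q → EdgeDisjoint q → x ∈ verts q →
                       DisjPathFrom u x × DisjPathFrom x v
  DisjPathFrom-split {q = q} q-path q-disj x∈ with split-at q x∈
  ... | A , B , refl =
    (A , IsPath-++⁻ˡ A B q-path , λ k f → q-disj k f ∘ ∈-edges-++⁺ A ∘ inj₁) ,
    (B , IsPath-++⁻ʳ A B q-path , λ k f → q-disj k f ∘ ∈-edges-++⁺ A ∘ inj₂)

  coupling-point-exists : ∀ i {w x} → w ∈ verts (P i) → DisjPathFrom w x →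
                          Σ[ u ∈ Fin n ] Σ[ q ∈ Walk E u x ] Q i x ≡ just (u , q)
  coupling-point-exists i {x = x} w∈ w⇝x with Q i x in Q-i-x
  ... | just (u , q) = u , q , refl
  ... | nothing = ⊥-elim (¬¬-minimal {D = λ w → DisjPathFrom w x} (strand-path i) w∈ w⇝x
                            λ (u , u-min) → Q-nothing i x Q-i-x u u-min)

  module _ {i v u} {q : Walk E u v} (Q-i-v : Q i v ≡ just (u , q)) where

    coupling-point-∈ : u ∈ verts (P i)
    coupling-point-∈ = proj₁ (proj₁ (Q-just i v u q Q-i-v))

    coupling-point-minimal : ∀ {w} → w ∈ verts (P i) → DisjPathFrom w v →
                             ¬ Before (verts (P i)) w u
    coupling-point-minimal = proj₂ (proj₂ (proj₁ (Q-just i v u q Q-i-v))) _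

    coupling-path-isPath : IsPath q
    coupling-path-isPath = proj₁ (proj₂ (Q-just i v u q Q-i-v))

    coupling-path-disjoint : EdgeDisjoint q
    coupling-path-disjoint = proj₂ (proj₂ (Q-just i v u q Q-i-v))

  -- The condition under which H_(s,t) contains the coupling path Q^i_v.
  Kept : Fin 2 → Fin 2 → Fin n → Fin n → Set
  Kept i j v u = ∀ v' u' (q' : Walk E u' v') → Before (verts (P j)) v v' →
                 Q i v' ≡ just (u' , q') → Before (verts (P i)) u u'

  module Coupled {i j u v} (A : Walk E s u) (B : Walk E u t) (D : Walk E s v) (F : Walk E v t)
                 {q : Walk E u v} (P-i : P i ≡ A ++ᵂ B) (P-j : P j ≡ D ++ᵂ F)
                 (Q-i-v : Q i v ≡ just (u , q)) (kept : Kept i j v u) where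

    later-coupling-point : ∀ {w x} → x ∈ tailVerts F → w ∈ verts (P i) → DisjPathFrom w x →
                           Σ[ u' ∈ Fin n ] Σ[ q' ∈ Walk E u' x ]
                             Q i x ≡ just (u' , q') × Before (verts (P i)) u u'
    later-coupling-point x∈F w∈ w⇝x with coupling-point-exists i w∈ w⇝x
    ... | u' , q' , Q-i-x = u' , q' , Q-i-x , kept _ u' q' (Before-split⁺ʳ D F P-j x∈F) Q-i-x

    coupling-path-prefix : ∀ {x} → x ∈ verts q → DisjPathFrom u x
    coupling-path-prefix =
      proj₁ ∘ DisjPathFrom-split (coupling-path-isPath Q-i-v) (coupling-path-disjoint Q-i-v)

    coupling-path-suffix : ∀ {x} → x ∈ verts q → DisjPathFrom x v
    coupling-path-suffix =
      proj₂ ∘ DisjPathFrom-split (coupling-path-isPath Q-i-v) (coupling-path-disjoint Q-i-v)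

    later-not-on-coupling-path : ∀ {x} → x ∈ tailVerts F → x ∉ verts q
    later-not-on-coupling-path x∈F x∈q
      with later-coupling-point x∈F (coupling-point-∈ Q-i-v) (coupling-path-prefix x∈q)
    ... | _ , _ , Q-i-x , u<u' =
      coupling-point-minimal Q-i-x (coupling-point-∈ Q-i-v) (coupling-path-prefix x∈q) u<u'

    earlier-not-on-rest : ∀ {x} → Before (verts (P i)) x u → x ∉ verts (q ++ᵂ F)
    earlier-not-on-rest x<u x∈qF with ∈-verts-++⁻ q x∈qF
    ... | inj₁ x∈q = coupling-point-minimal Q-i-v (Before-∈ˡ x<u) (coupling-path-suffix x∈q) x<u
    ... | inj₂ x∈F with later-coupling-point x∈F (Before-∈ˡ x<u) (DisjPathFrom-refl _)
    ...   | _ , _ , Q-i-x , u<u' =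
      coupling-point-minimal Q-i-x (Before-∈ˡ x<u) (DisjPathFrom-refl _)
        (Before-trans (strand-path i) x<u u<u')

    coupled-path-isPath : IsPath (A ++ᵂ q ++ᵂ F)
    coupled-path-isPath =
      IsPath-++⁺ (IsPath-initVerts A (IsPath-++⁻ˡ A B (subst IsPath P-i (strand-path i))))
                 (IsPath-++⁺ (IsPath-initVerts q (coupling-path-isPath Q-i-v))
                             (IsPath-++⁻ʳ D F (subst IsPath P-j (strand-path j)))
                             coupling-path-misses-suffix)
                 λ (x∈A , x∈qF) → earlier-not-on-rest (Before-split⁺ˡ A B P-i x∈A) x∈qF
      where
      coupling-path-misses-suffix : Disjoint (initVerts q) (verts F)
      coupling-path-misses-suffix (x∈q , x∈F) with ∈-verts⁻ F x∈F
      ... | inj₁ refl = IsPath-last∉initVerts q (coupling-path-isPath Q-i-v) x∈q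
      ... | inj₂ x∈F′ = later-not-on-coupling-path x∈F′ (initVerts⊆verts q x∈q)

    coupling-path-inH : All (InH C) (edges q)
    coupling-path-inH =
      All.tabulate λ f∈ → inj₂ (i , j , v , u , q , junction∈verts D F P-j , Q-i-v , f∈ , kept)

    coupled-path-inH : All (InH C) (edges (A ++ᵂ q ++ᵂ F))
    coupled-path-inH rewrite edges-++ A (q ++ᵂ F) | edges-++ q F =
      All.++⁺ (All.tabulate λ f∈ → inj₁ (i , ∈-edges-split⁺ A B P-i (inj₁ f∈)))
        (All.++⁺ coupling-path-inH
                 (All.tabulate λ f∈ → inj₁ (j , ∈-edges-split⁺ D F P-j (inj₂ f∈))))

    coupled-path-nice : IsNice C (A ++ᵂ q ++ᵂ F)
    coupled-path-nice = i , j , u , v , A , B , D , F , q , P-i , P-j , refl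
                      , inj₂ (Q-i-v , coupling-path-inH , coupling-path-disjoint Q-i-v)

  NotAfter : Fin 2 → Fin n → Fin n → Set
  NotAfter i y x =
    Σ[ u ∈ Fin n ] Σ[ q ∈ Walk E u x ] Q i x ≡ just (u , q) × ¬ Before (verts (P i)) y u

  NotAfter? : ∀ i y → Decidable (NotAfter i y)
  NotAfter? i y x with Q i x
  ... | nothing = no λ { (_ , _ , () , _) }
  ... | just (u , q) with before? Fin._≟_ (verts (P i)) y u
  ...   | yes y<u = no λ { (_ , _ , refl , y≮u) → y≮u y<u }
  ...   | no y≮u  = yes (u , q , refl , y≮u)

  NotAfter-via-detour : ∀ {i y x} → y ∈ verts (P i) → DisjPathFrom y x → NotAfter i y x
  NotAfter-via-detour {i} y∈ y⇝x with coupling-point-exists i y∈ y⇝x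
  ... | u , q , Q-i-x = u , q , Q-i-x , coupling-point-minimal Q-i-x y∈ y⇝x

  ¬NotAfter⇒after : ∀ {i y x u} {q : Walk E u x} → ¬ NotAfter i y x → Q i x ≡ just (u , q) →
                    Before (verts (P i)) y u
  ¬NotAfter⇒after {i} {y} {u = u} ¬y≮u Q-i-x =
    decidable-stable (before? Fin._≟_ (verts (P i)) y u) λ y≮u → ¬y≮u (_ , _ , Q-i-x , y≮u)

  record Separated (f₁ f₂ : Edge n) : Set where
    field
      f₁-on-strand : OnStrand f₁
      f₂-on-strand : OnStrand f₂
      not-both     : ∀ k → f₁ ∈ edges (P k) → f₂ ∈ edges (P k) → ⊥

  Hits : Edge n → Edge n → Fin 2 → Set
  Hits f₁ f₂ k = f₁ ∈ edges (P k) ⊎ f₂ ∈ edges (P k)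

  hits? : ∀ f₁ f₂ k → Dec (Hits f₁ f₂ k)
  hits? f₁ f₂ k = f₁ ∈? edges (P k) ⊎-dec f₂ ∈? edges (P k)

  separated : ∀ {f₁ f₂} → ¬ CutEdge f₁ → ¬ CutEdge f₂ →
              Hits f₁ f₂ zero → Hits f₁ f₂ (suc zero) → Separated f₁ f₂
  separated {f₁} {f₂} ¬cut₁ ¬cut₂ hit₀ hit₁ = record
    { f₁-on-strand = first-on-strand ¬cut₂ hit₀ hit₁
    ; f₂-on-strand = first-on-strand ¬cut₁ (Sum.swap hit₀) (Sum.swap hit₁)
    ; not-both     = not-both
    }
    where
    unshared : ∀ {f} → ¬ CutEdge f → f ∈ edges (P zero) → f ∈ edges (P (suc zero)) → ⊥
    unshared ¬cut f∈₀ f∈₁ = ¬cut (common-edge-cut _ f∈₀ f∈₁)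
    first-on-strand : ∀ {f g} → ¬ CutEdge g → Hits f g zero → Hits f g (suc zero) → OnStrand f
    first-on-strand _    (inj₁ f∈₀) _          = zero , f∈₀
    first-on-strand _    (inj₂ _)   (inj₁ f∈₁) = suc zero , f∈₁
    first-on-strand ¬cut (inj₂ g∈₀) (inj₂ g∈₁) = ⊥-elim (unshared ¬cut g∈₀ g∈₁)
    not-both : ∀ k → f₁ ∈ edges (P k) → f₂ ∈ edges (P k) → ⊥
    not-both zero       f₁∈₀ f₂∈₀ = [ unshared ¬cut₁ f₁∈₀ , unshared ¬cut₂ f₂∈₀ ]′ hit₁
    not-both (suc zero) f₁∈₁ f₂∈₁ = [ flip (unshared ¬cut₁) f₁∈₁ , flip (unshared ¬cut₂) f₂∈₁ ]′ hit₀

  module Failures {f₁ f₂ : Edge n} (R : Walk E s t) (R-path : IsPath R)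
                  (f₁∉R : f₁ ∉ edges R) (f₂∉R : f₂ ∉ edges R)
                  (sep : Separated f₁ f₂) where

    open Separated sep

    Avoids : List (Edge n) → Set
    Avoids es = f₁ ∉ es × f₂ ∉ es

    Avoids-++ : ∀ {u w v} {A : Walk E u w} {B : Walk E w v} →
                Avoids (edges A) → Avoids (edges B) → Avoids (edges (A ++ᵂ B))
    Avoids-++ (f₁∉A , f₂∉A) (f₁∉B , f₂∉B) = ∉-edges-++ f₁∉A f₁∉B , ∉-edges-++ f₂∉A f₂∉B

    Avoids-++⁻ˡ : ∀ {u w v} (A : Walk E u w) (B : Walk E w v) →
                  Avoids (edges (A ++ᵂ B)) → Avoids (edges A)
    Avoids-++⁻ˡ A B (f₁∉ , f₂∉) = f₁∉ ∘ ∈-edges-++⁺ A ∘ inj₁ , f₂∉ ∘ ∈-edges-++⁺ A ∘ inj₁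

    Avoids-++⁻ʳ : ∀ {u w v} (A : Walk E u w) (B : Walk E w v) →
                  Avoids (edges (A ++ᵂ B)) → Avoids (edges B)
    Avoids-++⁻ʳ A B (f₁∉ , f₂∉) = f₁∉ ∘ ∈-edges-++⁺ A ∘ inj₂ , f₂∉ ∘ ∈-edges-++⁺ A ∘ inj₂

    EdgeDisjoint⇒Avoids : ∀ {u v} {q : Walk E u v} → EdgeDisjoint q → Avoids (edges q)
    EdgeDisjoint⇒Avoids {q = q} q-disj = off f₁-on-strand , off f₂-on-strand
      where
      off : ∀ {f} → OnStrand f → f ∉ edges q
      off (k , f∈P) f∈q = q-disj k _ f∈q f∈P

    CleanPrefix : Fin 2 → Fin n → Set
    CleanPrefix i y = Σ[ A ∈ Walk E s y ] Σ[ B ∈ Walk E y t ] P i ≡ A ++ᵂ B × Avoids (edges A)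

    CleanSuffix : Fin 2 → Fin n → Set
    CleanSuffix j z = Σ[ D ∈ Walk E s z ] Σ[ F ∈ Walk E z t ] P j ≡ D ++ᵂ F × Avoids (edges F)

    CleanPrefix⇒∈ : ∀ {i y} → CleanPrefix i y → y ∈ verts (P i)
    CleanPrefix⇒∈ (A , B , P-i , _) = junction∈verts A B P-i

    CleanPrefix-before : ∀ {i y u} → CleanPrefix i y → Before (verts (P i)) u y → CleanPrefix i u
    CleanPrefix-before {i} (A , B , P-i , A-clean) u<y
      with split-at A (initVerts⊆verts A (Before-split⁻ˡ A B P-i (strand-path i) u<y))
    ... | A₁ , A₂ , refl =
      A₁ , A₂ ++ᵂ B , trans P-i (++ᵂ-assoc A₁ A₂ B) , Avoids-++⁻ˡ A₁ A₂ A-clean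

    CleanPrefix-≯ : ∀ {i y u} → CleanPrefix i y → u ∈ verts (P i) →
                    ¬ Before (verts (P i)) y u → CleanPrefix i u
    CleanPrefix-≯ y-clean u∈ y≮u with Before-trichotomy u∈ (CleanPrefix⇒∈ y-clean)
    ... | inj₁ u<y         = CleanPrefix-before y-clean u<y
    ... | inj₂ (inj₁ refl) = y-clean
    ... | inj₂ (inj₂ y<u)  = ⊥-elim (y≮u y<u)

    CleanPrefix-step : ∀ {k c c'} → CleanPrefix k c →
                       (c , c') ∈ edges (P k) → (c , c') ∈ edges R → CleanPrefix k c'
    CleanPrefix-step {k} {c} {c'} (A , B , P-k , A-clean) on-P on-R
      with edge-after-split A B P-k (strand-path k) on-P
    ... | e , B' , refl = A ++ᵂ c ∷⟨ e ⟩ [ c' ] , B' , trans P-k (sym (++ᵂ-assoc A _ B'))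
                        , Avoids-++ A-clean (off-R f₁∉R , off-R f₂∉R)
      where
      off-R : ∀ {f} → f ∉ edges R → f ∉ (c , c') ∷ []
      off-R f∉R (here refl) = f∉R on-R

    split-clean : ∀ {k c} (A : Walk E s c) (B : Walk E c t) → P k ≡ A ++ᵂ B →
                  Avoids (edges A) ⊎ Avoids (edges B)
    split-clean {k} A B P-k = classify (f₁ ∈? edges A) (f₂ ∈? edges A)
      where
      edges-disjoint : Disjoint (edges A) (edges B)
      edges-disjoint = IsPath-++⇒Disjoint-edges A B (subst IsPath P-k (strand-path k))
      on-P : ∀ {f} → f ∈ edges A ⊎ f ∈ edges B → f ∈ edges (P k)
      on-P = ∈-edges-split⁺ A B P-k
      classify : Dec (f₁ ∈ edges A) → Dec (f₂ ∈ edges A) → Avoids (edges A) ⊎ Avoids (edges B)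
      classify (no f₁∉A) (no f₂∉A) = inj₁ (f₁∉A , f₂∉A)
      classify (yes f₁∈A) _ = inj₂
        ( (λ f₁∈B → edges-disjoint (f₁∈A , f₁∈B))
        , (λ f₂∈B → not-both k (on-P (inj₁ f₁∈A)) (on-P (inj₂ f₂∈B))) )
      classify (no _) (yes f₂∈A) = inj₂
        ( (λ f₁∈B → not-both k (on-P (inj₂ f₁∈B)) (on-P (inj₁ f₂∈A)))
        , (λ f₂∈B → edges-disjoint (f₂∈A , f₂∈B)) )

    clean-prefix-or-suffix : ∀ k {c} → c ∈ verts (P k) → CleanPrefix k c ⊎ CleanSuffix k c
    clean-prefix-or-suffix k c∈ with split-at (P k) c∈
    ... | A , B , P-k = Sum.map (λ A-clean → A , B , P-k , A-clean) (λ B-clean → A , B , P-k , B-clean)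
                                (split-clean A B P-k)

    record Crossing : Set where
      field
        i j    : Fin 2
        y z    : Fin n
        prefix : CleanPrefix i y
        suffix : CleanSuffix j z
        detour : DisjPathFrom y z

    segment-isPath : ∀ {a b} (Pre : Walk E s a) (S : Walk E a b) (Rest : Walk E b t) →
                     R ≡ Pre ++ᵂ S ++ᵂ Rest → IsPath S
    segment-isPath Pre S Rest R≡ =
      IsPath-++⁻ˡ S Rest (IsPath-++⁻ʳ Pre (S ++ᵂ Rest) (subst IsPath R≡ R-path))

    crossing-from : ∀ {i y c} → CleanPrefix i y →
                    (Pre : Walk E s y) (S : Walk E y c) (Rest : Walk E c t) →
                    R ≡ Pre ++ᵂ S ++ᵂ Rest → EdgeDisjoint S → Crossing
    crossing-from y-clean Pre S [ c ] R≡ S-disj = record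
      { prefix = y-clean
      ; suffix = P zero , [ c ] , sym (++ᵂ-identityʳ (P zero)) , (λ ()) , (λ ())
      ; detour = S , segment-isPath Pre S [ c ] R≡ , S-disj
      }
    crossing-from y-clean Pre S (_∷⟨_⟩_ c {c'} e Rest) R≡ S-disj with on-strand? (c , c')
    ... | no off = crossing-from y-clean Pre (S ++ᵂ c ∷⟨ e ⟩ [ c' ]) Rest
                     (trans R≡ (cong (Pre ++ᵂ_) (sym (++ᵂ-assoc S _ Rest))))
                     (EdgeDisjoint-++⁺ S-disj λ { k _ (here refl) on-P → off (k , on-P) })
    ... | yes (k , on-P)
      with clean-prefix-or-suffix k (initVerts⊆verts (P k) (source∈initVerts (P k) on-P))
    ...   | inj₂ c-clean = record
      { prefix = y-clean ; suffix = c-clean ; detour = S , segment-isPath Pre S _ R≡ , S-disj }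
    ...   | inj₁ c-clean = crossing-from (CleanPrefix-step c-clean on-P on-R)
                             (Pre ++ᵂ S ++ᵂ c ∷⟨ e ⟩ [ c' ]) [ c' ] Rest R≡′ (λ _ _ ())
      where
      on-R : (c , c') ∈ edges R
      on-R = ∈-edges-split⁺ Pre (S ++ᵂ c ∷⟨ e ⟩ Rest) R≡
               (inj₂ (∈-edges-++⁺ S (inj₂ (here refl))))
      R≡′ : R ≡ (Pre ++ᵂ S ++ᵂ c ∷⟨ e ⟩ [ c' ]) ++ᵂ Rest
      R≡′ = begin
        R                                         ≡⟨ R≡ ⟩
        Pre ++ᵂ S ++ᵂ c ∷⟨ e ⟩ Rest              ≡⟨ cong (Pre ++ᵂ_) (++ᵂ-assoc S _ Rest) ⟨
        Pre ++ᵂ (S ++ᵂ c ∷⟨ e ⟩ [ c' ]) ++ᵂ Rest ≡⟨ ++ᵂ-assoc Pre _ Rest ⟨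
        (Pre ++ᵂ S ++ᵂ c ∷⟨ e ⟩ [ c' ]) ++ᵂ Rest ∎

    record Shortcut : Set where
      field
        i j      : Fin 2
        u v      : Fin n
        q        : Walk E u v
        coupling : Q i v ≡ just (u , q)
        prefix   : CleanPrefix i u
        suffix   : CleanSuffix j v
        kept     : Kept i j v u

    shortcut : Crossing → Shortcut
    shortcut record { i = i ; j = j ; y = y ; prefix = y-clean
                    ; suffix = D , F , P-j , F-clean ; detour = y⇝z }
      with last-split (NotAfter? i y) F (NotAfter-via-detour (CleanPrefix⇒∈ y-clean) y⇝z)
    ... | v , F₁ , F₂ , refl , (u , q , Q-i-v , y≮u) , none-later = record
      { coupling = Q-i-v
      ; prefix   = CleanPrefix-≯ y-clean (coupling-point-∈ Q-i-v) y≮u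
      ; suffix   = D ++ᵂ F₁ , F₂ , P-j′ , Avoids-++⁻ʳ F₁ F₂ F-clean
      ; kept     = λ v' u' q' v<v' Q-i-v' →
          ≮-Before-trans (strand-path i) (coupling-point-∈ Q-i-v) y≮u
            (¬NotAfter⇒after (All.lookup none-later
                               (Before-split⁻ʳ (D ++ᵂ F₁) F₂ P-j′ (strand-path j) v<v'))
                             Q-i-v')
      }
      where
      P-j′ : P j ≡ (D ++ᵂ F₁) ++ᵂ F₂
      P-j′ = trans P-j (sym (++ᵂ-assoc D F₁ F₂))

    nice-path : Shortcut → NiceAvoiding f₁ f₂
    nice-path record { q = q ; coupling = Q-i-v ; kept = kept
                     ; prefix = A , B , P-i , A-clean ; suffix = D , F , P-j , F-clean } =
      A ++ᵂ q ++ᵂ F , coupled-path-isPath , coupled-path-inH ,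
      proj₁ clean , proj₂ clean , coupled-path-nice
      where
      open Coupled A B D F P-i P-j Q-i-v kept
      clean : Avoids (edges (A ++ᵂ q ++ᵂ F))
      clean = Avoids-++ A-clean (Avoids-++ (EdgeDisjoint⇒Avoids (coupling-path-disjoint Q-i-v)) F-clean)

    nice-avoiding-path : NiceAvoiding f₁ f₂
    nice-avoiding-path = nice-path (shortcut (crossing-from s-clean [ s ] [ s ] R refl (λ _ _ ())))
      where
      s-clean : CleanPrefix zero s
      s-clean = [ s ] , P zero , refl , (λ ()) , (λ ())

  strand-avoiding : ∀ {f₁ f₂} k → ¬ Hits f₁ f₂ k → NiceAvoiding f₁ f₂
  strand-avoiding k miss =
    P k , strand-path k , All.tabulate (λ f∈ → inj₁ (k , f∈)) , miss ∘ inj₁ , miss ∘ inj₂ ,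
    k , k , t , t , P k , [ t ] , P k , [ t ] , [ t ] , P≡ , P≡ , P≡ , inj₁ refl
    where
    P≡ : P k ≡ P k ++ᵂ [ t ]
    P≡ = sym (++ᵂ-identityʳ (P k))

  nice-path-avoiding : ∀ {f₁ f₂} (R : Walk E s t) → IsPath R → f₁ ∉ edges R → f₂ ∉ edges R →
                       NiceAvoiding f₁ f₂
  nice-path-avoiding {f₁} {f₂} R R-path f₁∉R f₂∉R
    with hits? f₁ f₂ zero | hits? f₁ f₂ (suc zero)
  ... | no miss  | _        = strand-avoiding zero miss
  ... | yes _    | no miss  = strand-avoiding (suc zero) miss
  ... | yes hit₀ | yes hit₁ =
    Failures.nice-avoiding-path R R-path f₁∉R f₂∉R
      (separated (λ cut → cut (R , R-path , f₁∉R)) (λ cut → cut (R , R-path , f₂∉R)) hit₀ hit₁)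

claim3p1 : ∀ {n} (E : Fin n → Fin n → Set) (s t : Fin n) →
    (Σ[ R ∈ Walk E s t ] IsPath R) →
    (P : Fin 2 → Walk E s t) → Setting.OuterStrands E s t P →
    (C : Setting.CouplingChoice E s t P) →
    (f₁ f₂ : Edge n) → E (proj₁ f₁) (proj₂ f₁) → E (proj₁ f₂) (proj₂ f₂) →
    (Σ[ R ∈ Walk E s t ] IsPath R × f₁ ∉ edges R × f₂ ∉ edges R) →
    Σ[ R ∈ Walk E s t ]
      IsPath R × All (Setting.InH E s t P C) (edges R) ×
      f₁ ∉ edges R × f₂ ∉ edges R × Setting.IsNice E s t P C R
claim3p1 E s t _ P strands C f₁ f₂ _ _ (R , R-path , f₁∉R , f₂∉R) =
  Strands.nice-path-avoiding E s t P strands C R R-path f₁∉R f₂∉R
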